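{- For any non-constant $f:\{0,1\}^n\to\{0,1\}$ and any $i\in[n]$, $\textsc{BalInf}_i(f)=\dfrac{\mathrm{Inf}_i(f)}{4\,\mathrm{Var}(f)}$.
   Context: $\mathrm{Inf}_i(f)=\Pr_{x}[f(x)\ne f(x^{\oplus i})]$ for uniform $x\in\{0,1\}^n$, $x^{\oplus i}$ being $x$ with bit $i$ flipped. $\mathrm{Var}(f)=\Pr_x[f(x)=0]\Pr_x[f(x)=1]$. The balanced distribution $\mathcal{D}_{\mathrm{bal}}^{(f)}$ is sampled by drawing a uniform bit $b$ and then uniform $x\in f^{ -1}(b)$; $\textsc{BalInf}_i(f)=\Pr_{x\sim\mathcal{D}_{\mathrm{bal}}^{(f)}}[f(x)\ne f(x^{\oplus i})]$. -}

module Defs where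

open import Data.Bool using (Bool; true; false; not; if_then_else_)
open import Data.Nat as ℕ using (ℕ; zero; suc; _^_)
open import Data.Fin using (Fin)
open import Data.Vec using (Vec; []; _∷_; _[_]≔_; lookup)
open import Data.List using (List; []; _∷_; map; _++_; length; filter)
open import Data.Integer using (+_)
open import Data.Rational using (ℚ; _/_; _*_; _÷_; 0ℚ; ≢-nonZero)
open import Data.Rational.Properties using (_≟_)
open import Relation.Nullary using (yes; no; ¬_)
open import Relation.Binary.PropositionalEquality using (_≡_)
open import Data.Bool.Properties using () renaming (_≟_ to _≟ᵇ_)

-- The Boolean cube {0,1}^n (false = 0, true = 1).
Cube : ℕ → Set
Cube n = Vec Bool n

allPoints : (n : ℕ) → List (Cube n)
allPoints zero = [] ∷ []
allPoints (suc n) = map (false ∷_) (allPoints n) ++ map (true ∷_) (allPoints n)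

flip : ∀ {n} → Cube n → Fin n → Cube n
flip x i = x [ i ]≔ not (lookup x i)

count : (n : ℕ) → (Cube n → Bool) → ℕ
count n P = length (filter (λ x → P x ≟ᵇ true) (allPoints n))

-- a / b as a rational, with the convention a / 0 = 0 (only used where b ≠ 0).
frac : ℕ → ℕ → ℚ
frac a zero = 0ℚ
frac a (suc b) = (+ a) / suc b

-- Total rational division, p ÷ 0 = 0 (only used where q ≠ 0).
_÷'_ : ℚ → ℚ → ℚ
p ÷' q with q ≟ 0ℚ
... | yes _ = 0ℚ
... | no q≢0 = _÷_ p q {{≢-nonZero q≢0}}

Pr : (n : ℕ) → (Cube n → Bool) → ℚ
Pr n P = frac (count n P) (2 ^ n)

PrCond : (n : ℕ) → (S : Cube n → Bool) → (P : Cube n → Bool) → ℚ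
PrCond n S P = frac (count n (λ x → if S x then P x else false)) (count n S)

isValue : Bool → Bool → Bool
isValue true b = b
isValue false b = not b

differs : ∀ {n} → (Cube n → Bool) → Fin n → Cube n → Bool
differs f i x = not (isValue (f x) (f (flip x i)))

Inf : ∀ {n} → (Cube n → Bool) → Fin n → ℚ
Inf {n} f i = Pr n (differs f i)

Var : ∀ {n} → (Cube n → Bool) → ℚ
Var {n} f = Pr n (λ x → not (f x)) * Pr n f

-- BalInf_i(f): b uniform in {0,1}, then x uniform in f⁻¹(b).
BalInf : ∀ {n} → (Cube n → Bool) → Fin n → ℚ
BalInf {n} f i =
  Data.Rational._+_ ((+ 1 / 2) * PrCond n (λ x → not (f x)) (differs f i))
                    ((+ 1 / 2) * PrCond n f (differs f i))

NonConstant : ∀ {n} → (Cube n → Bool) → Set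
NonConstant {n} f = Data.Product.Σ (Cube n) λ x → Data.Product.Σ (Cube n) λ y → ¬ (f x ≡ f y)
  where import Data.Product

-- Let A = |f⁻¹(0)|, B = |f⁻¹(1)|, N = 2ⁿ = A + B, and let d be the number of
-- points x with f x = 0 and f (x ⊕ i) = 1. Flipping bit i is an involution
-- exchanging these points with those of f⁻¹(1) whose i-neighbour lies in
-- f⁻¹(0), so both sides of the boundary have d points. Hence
-- Inf = 2d/N, Var = AB/N² and BalInf = ½ (d/A + d/B) = dN/(2AB) = Inf/(4 Var).
module Submission where

open import Defs
open import Data.Bool using (Bool; true; false; not; if_then_else_)
open import Data.Bool.Properties using (not-involutive) renaming (_≟_ to _≟ᵇ_)
open import Data.Nat as ℕ using (ℕ; zero; suc; _+_; _^_; _<_; NonZero; >-nonZero)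
open import Data.Nat.Properties using (+-comm; +-suc; +-identityʳ)
open import Data.Fin using (Fin; zero; suc)
open import Data.Vec using ([]; _∷_)
open import Data.List using (List; []; _∷_; map; _++_; length; filter)
open import Data.List.Properties using (length-++; length-map; filter-++)
open import Data.List.Membership.Propositional using (_∈_)
open import Data.List.Membership.Propositional.Properties
  using (∈-filter⁺; ∈-length; ∈-map⁺; ∈-++⁺ˡ; ∈-++⁺ʳ)
open import Data.List.Relation.Unary.Any using (here)
open import Data.Integer as ℤ using (+_)
import Data.Integer.Properties as ℤ
open import Data.Rational
  using (ℚ; _*_; _/_; _÷_; 0ℚ; 1ℚ; 1/_; toℚᵘ; Positive; ≢-nonZero)
import Data.Rational as ℚ
open import Data.Rational.Properties
  using (_≟_; toℚᵘ-injective; toℚᵘ-fromℚᵘ; toℚᵘ-homo-*; toℚᵘ-homo-+;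
         *-inverseʳ; *-assoc; *-identityʳ; normalize-pos; pos*pos⇒pos; pos⇒nonZero)
open import Data.Rational.Unnormalised as ℚᵘ using (mkℚᵘ; *≡*)
import Data.Rational.Unnormalised.Properties as ℚᵘ
open import Data.Rational.Solver using (module +-*-Solver)
open import Data.Product using (∃; _×_; _,_)
open import Data.Empty using (⊥-elim; ⊥-elim-irr)
open import Relation.Nullary using (yes; no)
open import Relation.Binary.PropositionalEquality

countIn : {A : Set} → (A → Bool) → List A → ℕ
countIn P xs = length (filter (λ x → P x ≟ᵇ true) xs)

module _ {A : Set} where

  countIn-++ : (P : A → Bool) (xs ys : List A) →
    countIn P (xs ++ ys) ≡ countIn P xs + countIn P ys
  countIn-++ P xs ys =
    trans (cong length (filter-++ (λ x → P x ≟ᵇ true) xs ys)) (length-++ (filter (λ x → P x ≟ᵇ true) xs))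

  countIn-map : {B : Set} (P : B → Bool) (g : A → B) (xs : List A) →
    countIn P (map g xs) ≡ countIn (λ x → P (g x)) xs
  countIn-map P g [] = refl
  countIn-map P g (x ∷ xs) with P (g x)
  ... | true  = cong suc (countIn-map P g xs)
  ... | false = countIn-map P g xs

  countIn-cong : {P Q : A → Bool} → (∀ x → P x ≡ Q x) → (xs : List A) →
    countIn P xs ≡ countIn Q xs
  countIn-cong P≗Q [] = refl
  countIn-cong {P} {Q} P≗Q (x ∷ xs) with P x | Q x | P≗Q x
  ... | true  | true  | refl = cong suc (countIn-cong P≗Q xs)
  ... | false | false | refl = countIn-cong P≗Q xs

  countIn-partition : (Q P : A → Bool) (xs : List A) →
    countIn P xs ≡ countIn (λ x → if not (Q x) then P x else false) xs
                 + countIn (λ x → if Q x then P x else false) xs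
  countIn-partition Q P [] = refl
  countIn-partition Q P (x ∷ xs) with Q x | P x
  ... | true  | true  = trans (cong suc (countIn-partition Q P xs)) (sym (+-suc _ _))
  ... | true  | false = countIn-partition Q P xs
  ... | false | true  = cong suc (countIn-partition Q P xs)
  ... | false | false = countIn-partition Q P xs

  countIn-not+countIn : (Q : A → Bool) (xs : List A) →
    countIn (λ x → not (Q x)) xs + countIn Q xs ≡ length xs
  countIn-not+countIn Q [] = refl
  countIn-not+countIn Q (x ∷ xs) with Q x
  ... | true  = trans (+-suc _ _) (cong suc (countIn-not+countIn Q xs))
  ... | false = cong suc (countIn-not+countIn Q xs)

  countIn-pos : (P : A → Bool) {x : A} {xs : List A} →
    x ∈ xs → P x ≡ true → 0 < countIn P xs
  countIn-pos P x∈xs Px = ∈-length (∈-filter⁺ (λ x → P x ≟ᵇ true) x∈xs Px)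

length-allPoints : (n : ℕ) → length (allPoints n) ≡ 2 ^ n
length-allPoints zero = refl
length-allPoints (suc n) = begin
  length (map (false ∷_) (allPoints n) ++ map (true ∷_) (allPoints n))
    ≡⟨ length-++ (map (false ∷_) (allPoints n)) ⟩
  length (map (false ∷_) (allPoints n)) + length (map (true ∷_) (allPoints n))
    ≡⟨ cong₂ _+_ (length-map (false ∷_) (allPoints n)) (length-map (true ∷_) (allPoints n)) ⟩
  length (allPoints n) + length (allPoints n)
    ≡⟨ cong₂ _+_ (length-allPoints n) (trans (length-allPoints n) (sym (+-identityʳ (2 ^ n)))) ⟩
  2 ^ n + (2 ^ n + 0) ∎
  where open ≡-Reasoning

∈-allPoints : {n : ℕ} (x : Cube n) → x ∈ allPoints n
∈-allPoints [] = here refl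
∈-allPoints (false ∷ x) = ∈-++⁺ˡ (∈-map⁺ (false ∷_) (∈-allPoints x))
∈-allPoints (true ∷ x) = ∈-++⁺ʳ (map (false ∷_) _) (∈-map⁺ (true ∷_) (∈-allPoints x))

count-suc : (n : ℕ) (P : Cube (suc n) → Bool) →
  count (suc n) P ≡ count n (λ x → P (false ∷ x)) + count n (λ x → P (true ∷ x))
count-suc n P = trans (countIn-++ P (map (false ∷_) (allPoints n)) _)
  (cong₂ _+_ (countIn-map P (false ∷_) (allPoints n)) (countIn-map P (true ∷_) (allPoints n)))

count-flip : (n : ℕ) (i : Fin n) (P : Cube n → Bool) →
  count n P ≡ count n (λ x → P (flip x i))
count-flip (suc n) zero P = begin
  count (suc n) P                                        ≡⟨ count-suc n P ⟩
  count n (λ x → P (false ∷ x)) + count n (λ x → P (true ∷ x))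
    ≡⟨ +-comm (count n (λ x → P (false ∷ x))) _ ⟩
  count n (λ x → P (true ∷ x)) + count n (λ x → P (false ∷ x))
    ≡⟨ count-suc n (λ x → P (flip x zero)) ⟨
  count (suc n) (λ x → P (flip x zero))                  ∎
  where open ≡-Reasoning
count-flip (suc n) (suc i) P = begin
  count (suc n) P                                        ≡⟨ count-suc n P ⟩
  count n (λ x → P (false ∷ x)) + count n (λ x → P (true ∷ x))
    ≡⟨ cong₂ _+_ (count-flip n i (λ x → P (false ∷ x))) (count-flip n i (λ x → P (true ∷ x))) ⟩
  count n (λ x → P (false ∷ flip x i)) + count n (λ x → P (true ∷ flip x i))
    ≡⟨ count-suc n (λ x → P (flip x (suc i))) ⟨
  count (suc n) (λ x → P (flip x (suc i)))               ∎
  where open ≡-Reasoning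

flip-involutive : {n : ℕ} (x : Cube n) (i : Fin n) → flip (flip x i) i ≡ x
flip-involutive (b ∷ x) zero = cong (_∷ x) (not-involutive b)
flip-involutive (b ∷ x) (suc i) = cong (b ∷_) (flip-involutive x i)

count-pos : {n : ℕ} (P : Cube n → Bool) {x : Cube n} → P x ≡ true → 0 < count n P
count-pos P Px = countIn-pos P (∈-allPoints _) Px

count-not+count : (n : ℕ) (Q : Cube n → Bool) → count n (λ x → not (Q x)) + count n Q ≡ 2 ^ n
count-not+count n Q = trans (countIn-not+countIn Q (allPoints n)) (length-allPoints n)

nonConstant⇒takes-both-values : {n : ℕ} (f : Cube n → Bool) → NonConstant f →
  (∃ λ x → f x ≡ false) × (∃ λ y → f y ≡ true)
nonConstant⇒takes-both-values f (x , y , fx≢fy) with f x in fx | f y in fy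
... | false | true  = (x , fx) , (y , fy)
... | true  | false = (y , fy) , (x , fx)
... | false | false = ⊥-elim (fx≢fy refl)
... | true  | true  = ⊥-elim (fx≢fy refl)

boundary : {n : ℕ} → (Cube n → Bool) → Fin n → Bool → Cube n → Bool
boundary f i b x = if isValue b (f x) then differs f i x else false

boundary-flip : {n : ℕ} (f : Cube n → Bool) (i : Fin n) (x : Cube n) →
  boundary f i true (flip x i) ≡ boundary f i false x
boundary-flip f i x rewrite flip-involutive x i with f x | f (flip x i)
... | false | false = refl
... | false | true  = refl
... | true  | false = refl
... | true  | true  = refl

count-boundary-true≡false : (n : ℕ) (f : Cube n → Bool) (i : Fin n) →
  count n (boundary f i true) ≡ count n (boundary f i false)
count-boundary-true≡false n f i =
  trans (count-flip n i (boundary f i true)) (countIn-cong (boundary-flip f i) (allPoints n))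

count-differs≡boundary+boundary : (n : ℕ) (f : Cube n → Bool) (i : Fin n) →
  count n (differs f i) ≡ count n (boundary f i false) + count n (boundary f i false)
count-differs≡boundary+boundary n f i =
  trans (countIn-partition f (differs f i) (allPoints n))
        (cong (λ k → count n (boundary f i false) + k) (count-boundary-true≡false n f i))

÷-unique : {x p : ℚ} (c : ℚ) .{{_ : ℚ.NonZero c}} → x * c ≡ p → x ≡ p ÷ c
÷-unique {x} {p} c x*c≡p = begin
  x                  ≡⟨ *-identityʳ x ⟨
  x * 1ℚ             ≡⟨ cong (x *_) (*-inverseʳ c) ⟨
  x * (c * 1/ c)     ≡⟨ *-assoc x c (1/ c) ⟨
  (x * c) * 1/ c     ≡⟨ cong (_* 1/ c) x*c≡p ⟩
  p ÷ c              ∎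
  where open ≡-Reasoning

÷'-unique : {x p : ℚ} (c : ℚ) .{{_ : ℚ.NonZero c}} → x * c ≡ p → x ≡ p ÷' c
÷'-unique c ⦃ c≢0 ⦄ x*c≡p with c ≟ 0ℚ
... | yes refl = ⊥-elim-irr (ℕ.NonZero.nonZero c≢0)
... | no c≢0ℚ = ÷-unique c ⦃ ≢-nonZero c≢0ℚ ⦄ x*c≡p

toℚᵘ-frac : (x m : ℕ) → toℚᵘ (frac x (suc m)) ℚᵘ.≃ mkℚᵘ (+ x) m
toℚᵘ-frac x m = toℚᵘ-fromℚᵘ (mkℚᵘ (+ x) m)

frac-pos : (x m : ℕ) → Positive (frac (suc x) (suc m))
frac-pos x m = normalize-pos (suc x) (suc m)

frac-self : (m : ℕ) → frac (suc m) (suc m) ≡ 1ℚ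
frac-self m = toℚᵘ-injective (ℚᵘ.≃-trans (toℚᵘ-frac (suc m) m) (*≡* (ℤ.*-comm (+ suc m) (+ 1))))

frac-*-frac : (x y m : ℕ) → frac x (suc y) * frac (suc y) (suc m) ≡ frac x (suc m)
frac-*-frac x y m = toℚᵘ-injective (begin
  toℚᵘ (frac x (suc y) * frac (suc y) (suc m))
    ≈⟨ toℚᵘ-homo-* (frac x (suc y)) (frac (suc y) (suc m)) ⟩
  toℚᵘ (frac x (suc y)) ℚᵘ.* toℚᵘ (frac (suc y) (suc m))
    ≈⟨ ℚᵘ.*-cong (toℚᵘ-frac x y) (toℚᵘ-frac (suc y) m) ⟩
  mkℚᵘ (+ x) y ℚᵘ.* mkℚᵘ (+ suc y) m
    ≈⟨ *≡* cross ⟩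
  mkℚᵘ (+ x) m
    ≈⟨ toℚᵘ-frac x m ⟨
  toℚᵘ (frac x (suc m)) ∎)
  where
  open ℚᵘ.≃-Reasoning
  cross : (+ x ℤ.* + suc y) ℤ.* + suc m ≡ + x ℤ.* + (suc y ℕ.* suc m)
  cross = trans (ℤ.*-assoc (+ x) (+ suc y) (+ suc m))
                (cong (+ x ℤ.*_) (sym (ℤ.pos-* (suc y) (suc m))))

frac-+ : (x y m : ℕ) → frac x (suc m) ℚ.+ frac y (suc m) ≡ frac (x + y) (suc m)
frac-+ x y m = toℚᵘ-injective (begin
  toℚᵘ (frac x (suc m) ℚ.+ frac y (suc m))
    ≈⟨ toℚᵘ-homo-+ (frac x (suc m)) (frac y (suc m)) ⟩
  toℚᵘ (frac x (suc m)) ℚᵘ.+ toℚᵘ (frac y (suc m))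
    ≈⟨ ℚᵘ.+-cong (toℚᵘ-frac x m) (toℚᵘ-frac y m) ⟩
  mkℚᵘ (+ x) m ℚᵘ.+ mkℚᵘ (+ y) m
    ≈⟨ *≡* cross ⟩
  mkℚᵘ (+ (x + y)) m
    ≈⟨ toℚᵘ-frac (x + y) m ⟨
  toℚᵘ (frac (x + y) (suc m)) ∎)
  where
  open ℚᵘ.≃-Reasoning
  M : ℕ
  M = suc m
  cross : (+ x ℤ.* + M ℤ.+ + y ℤ.* + M) ℤ.* + M ≡ + (x + y) ℤ.* + (M ℕ.* M)
  cross = trans (cong (ℤ._* + M) (sym (ℤ.*-distribʳ-+ (+ M) (+ x) (+ y))))
         (trans (ℤ.*-assoc (+ x ℤ.+ + y) (+ M) (+ M))
                (sym (cong₂ ℤ._*_ (ℤ.pos-+ x y) (ℤ.pos-* M M))))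

½frac+½frac≡frac÷4frac*frac : (A B d : ℕ) .{{_ : NonZero A}} .{{_ : NonZero B}} →
  (+ 1 / 2) * frac d A ℚ.+ (+ 1 / 2) * frac d B
    ≡ frac (d + d) (A + B) ÷' ((+ 4 / 1) * (frac A (A + B) * frac B (A + B)))
½frac+½frac≡frac÷4frac*frac (suc a) (suc b) d =
  ÷'-unique ((+ 4 / 1) * (α * β)) ⦃ pos⇒nonZero (+ 4 / 1 * (α * β)) ⦃ 4αβ-pos ⦄ ⦄ (begin
    (h * u ℚ.+ h * v) * (+ 4 / 1 * (α * β))
      ≡⟨ solve 6 (λ h u v f α β → (h :* u :+ h :* v) :* (f :* (α :* β))
                                := (h :* f) :* ((u :* α) :* β :+ (v :* β) :* α))
               refl h u v (+ 4 / 1) α β ⟩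
    (h * (+ 4 / 1)) * ((u * α) * β ℚ.+ (v * β) * α)
      ≡⟨ cong₂ (λ p q → (h * (+ 4 / 1)) * (p * β ℚ.+ q * α)) (frac-*-frac d a m) (frac-*-frac d b m) ⟩
    (+ 2 / 1) * (δ * β ℚ.+ δ * α)
      ≡⟨ solve 3 (λ δ α β → con (+ 2 / 1) :* (δ :* β :+ δ :* α)
                          := δ :* (α :+ β) :+ δ :* (α :+ β))
               refl δ α β ⟩
    δ * (α ℚ.+ β) ℚ.+ δ * (α ℚ.+ β)
      ≡⟨ cong (λ p → δ * p ℚ.+ δ * p) (trans (frac-+ (suc a) (suc b) m) (frac-self m)) ⟩
    δ * 1ℚ ℚ.+ δ * 1ℚ
      ≡⟨ cong₂ ℚ._+_ (*-identityʳ δ) (*-identityʳ δ) ⟩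
    δ ℚ.+ δ
      ≡⟨ frac-+ d d m ⟩
    frac (d + d) (suc m) ∎)
  where
  open ≡-Reasoning
  open +-*-Solver
  m : ℕ
  m = a + suc b
  h u v α β δ : ℚ
  h = + 1 / 2
  u = frac d (suc a)
  v = frac d (suc b)
  α = frac (suc a) (suc m)
  β = frac (suc b) (suc m)
  δ = frac d (suc m)
  4αβ-pos : Positive (+ 4 / 1 * (α * β))
  4αβ-pos = pos*pos⇒pos (+ 4 / 1) ⦃ normalize-pos 4 1 ⦄ (α * β)
              ⦃ pos*pos⇒pos α ⦃ frac-pos a m ⦄ β ⦃ frac-pos b m ⦄ ⦄

lemma6p3 : (n : ℕ) (f : Cube n → Bool) → NonConstant f → (i : Fin n) →
    BalInf f i ≡ Inf f i ÷' ((+ 4 / 1) * Var f)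
lemma6p3 n f nonConst i with nonConstant⇒takes-both-values f nonConst
... | (x₀ , fx₀≡0) , (x₁ , fx₁≡1) = begin
  BalInf f i
    ≡⟨ cong (λ k → ½ * frac d A ℚ.+ ½ * frac k B) (count-boundary-true≡false n f i) ⟩
  ½ * frac d A ℚ.+ ½ * frac d B
    ≡⟨ ½frac+½frac≡frac÷4frac*frac A B d ⟩
  frac (d + d) (A + B) ÷' (+ 4 / 1 * (frac A (A + B) * frac B (A + B)))
    ≡⟨ cong₂ (λ k N → frac k N ÷' (+ 4 / 1 * (frac A N * frac B N)))
             (sym (count-differs≡boundary+boundary n f i)) (count-not+count n f) ⟩
  Inf f i ÷' ((+ 4 / 1) * Var f) ∎
  where
  open ≡-Reasoning
  ½ : ℚ
  ½ = + 1 / 2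
  A B d : ℕ
  A = count n (λ x → not (f x))
  B = count n f
  d = count n (boundary f i false)
  instance
    A≢0 : NonZero A
    A≢0 = >-nonZero (count-pos (λ x → not (f x)) (cong not fx₀≡0))
    B≢0 : NonZero B
    B≢0 = >-nonZero (count-pos f fx₁≡1)
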